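{- Let $G$ be a connected graph on $[n]$. Then there exists a sequence of pairs $(i_1,j_1),\dots,(i_q,j_q)$ with each $1\le i_t<j_t\le n$ such that (i) $\{1,2\},\dots,\{1,n\}$ are edges of $\mathrm{Shift}_{i_qj_q}(\mathrm{Shift}_{i_{q-1}j_{q-1}}(\cdots\mathrm{Shift}_{i_1j_1}(G)\cdots))$, and (ii) for each $1\le t\le q$, $\mathrm{Shift}_{i_tj_t}$ is an edge shift of $\mathrm{Shift}_{i_{t-1}j_{t-1}}(\cdots\mathrm{Shift}_{i_1j_1}(G)\cdots)$ (for $t=1$, of $G$). In particular, there exists a combinatorial shifted graph $\Delta^c(G)$ of $G$ with $m_1(\Delta^c(G))=n-1$.
   Context: For $1\le i<j\le n$, $\mathrm{Shift}_{ij}(H)$ is the graph on $[n]$ whose edges are $C_{ij}(S)$ for $S\in E(H)$, where $C_{ij}(S)=(S\setminus\{j\})\cup\{i\}$ if $j\in S$, $i\notin S$ and $(S\setminus\{j\})\cup\{i\}\notin E(H)$, and $C_{ij}(S)=S$ otherwise. $\mathrm{Shift}_{ij}$ is an edge shift of $H$ if $\{i,j\}\in E(H)$. A graph on $[n]$ is shifted if for every edge $\{i,j\}$ and all $i'\le i$, $j'\le j$ with $i'\ne j'$, $\{i',j'\}$ is an edge; a combinatorial shifted graph of $G$ is any shifted graph of the form $\mathrm{Shift}_{i_qj_q}(\cdots\mathrm{Shift}_{i_1j_1}(G)\cdots)$ with $1\le i_t<j_t\le n$. For a graph $H$, $m_1(H)$ is the number of edges $\{i,j\}$ of $H$ with $\min\{i,j\}=1$.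 -}

module Defs where

open import Data.Nat using (ℕ; zero; suc; _∸_)
open import Data.Bool using (Bool; true; false; _∧_; not; if_then_else_)
open import Data.Bool.Properties using () renaming (_≟_ to _≟ᵇ_)
open import Data.Fin using (Fin; toℕ; _<_; _≤_)
open import Data.Fin.Subset using (Subset; ⁅_⁆; _∪_; ∣_∣; inside; outside)
open import Data.Vec using (Vec; lookup; _[_]≔_)
open import Data.Vec.Properties using (≡-dec)
open import Data.List using (List; []; _∷_; map; filterᵇ; length; allFin)
open import Data.List.Relation.Unary.All using (All)
open import Data.Product using (_×_; _,_; Σ)
open import Relation.Nullary using (¬_; Dec; does)
open import Relation.Binary.Definitions using (DecidableEquality)
open import Relation.Binary.PropositionalEquality using (_≡_; _≢_)
open import Relation.Binary.Construct.Closure.ReflexiveTransitive using (Star)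
import Data.List.Membership.DecPropositional as DecMem
open import Data.Unit using (⊤)
import Data.Fin as Fin

-- Vertex set [n] is modelled by Fin n: the paper's vertex k+1 is the Fin element k
-- (so the paper's vertex 1 is Fin.zero and the order is preserved).
-- An edge is a subset of Fin n (a bit vector, 'Subset n'); a graph H is given by
-- the list of its edges, E(H) = the set of elements of the list.

_≟ˢ_ : ∀ {n} → DecidableEquality (Subset n)
_≟ˢ_ = ≡-dec _≟ᵇ_

module _ {n : ℕ} where
  open DecMem (_≟ˢ_ {n}) public using (_∈_; _∈?_)

record Graph (n : ℕ) : Set where
  constructor graph
  field
    E        : List (Subset n)
    edges-2  : All (λ S → ∣ S ∣ ≡ 2) E

open Graph public

⟨_,_⟩ : ∀ {n} → Fin n → Fin n → Subset n
⟨ a , b ⟩ = ⁅ a ⁆ ∪ ⁅ b ⁆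

IsEdge : ∀ {n} → List (Subset n) → Fin n → Fin n → Set
IsEdge E a b = a ≢ b × ⟨ a , b ⟩ ∈ E

C : ∀ {n} → List (Subset n) → Fin n → Fin n → Subset n → Subset n
C E i j S =
  if lookup S j ∧ not (lookup S i) ∧ not (does (S′ ∈? E)) then S′ else S
  where S′ = (S [ j ]≔ outside) [ i ]≔ inside

ShiftE : ∀ {n} → Fin n → Fin n → List (Subset n) → List (Subset n)
ShiftE i j E = map (C E i j) E

Shifts : ∀ {n} → List (Fin n × Fin n) → List (Subset n) → List (Subset n)
Shifts []            E = E
Shifts ((i , j) ∷ p) E = Shifts p (ShiftE i j E)

AllOrdered : ∀ {n} → List (Fin n × Fin n) → Set
AllOrdered p = All (λ { (i , j) → i < j }) p

EdgeShiftSeq : ∀ {n} → List (Subset n) → List (Fin n × Fin n) → Set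
EdgeShiftSeq E []            = ⊤
EdgeShiftSeq E ((i , j) ∷ p) = IsEdge E i j × EdgeShiftSeq (ShiftE i j E) p

Connected : ∀ {n} → Graph n → Set
Connected {n} G = (a b : Fin n) → Star (IsEdge (E G)) a b

Shifted : ∀ {n} → List (Subset n) → Set
Shifted {n} E = (a b a′ b′ : Fin n) → IsEdge E a b → a′ ≤ a → b′ ≤ b → a′ ≢ b′ → IsEdge E a′ b′

m₁ : ∀ {n} → List (Subset (suc n)) → ℕ
m₁ {n} E = length (filterᵇ (λ k → does (⟨ Fin.zero , Fin.suc k ⟩ ∈? E)) (allFin n))

-- (i) Walk outwards from vertex 1 along paths of G.  If {1,u} is an edge and
-- {u,w} an edge of G, the edge shift Shift_{1u} turns {u,w} into {1,w} (unless
-- {1,w} is already present), and a shift Shift_{1x} never removes an edge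
-- through 1.  Hence the invariant: every edge of G either survives or has both
-- endpoints joined to 1; following a path from 1 to v then joins v to 1.
-- (ii) Keep applying shifts Shift_{ij}, i < j, that change the graph.  Each
-- strictly lowers the total weight  Σ_{S ∈ E} Σ_{p ∈ S} p,  so the process
-- stops at a graph fixed by all of them, which is shifted.  No such shift can
-- remove an edge {1,j}: it could only become {1,i}, which is already present.
-- So the full star at 1, and with it m₁ = n - 1, survives.
module Submission where

open import Defs
open import Data.Nat as ℕ using (ℕ; suc; _+_; z≤n)
import Data.Nat.Properties as ℕₚ
open import Data.Nat.Induction using (<-wellFounded)
open import Data.Nat.ListAction using (sum)
open import Data.Nat.Solver using (module +-*-Solver)
open import Data.Bool using (Bool; true; false; _∨_; if_then_else_; T)
open import Data.Bool.Properties using (∨-zeroʳ; T-≡)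
open import Data.Fin using (Fin; zero; suc; toℕ; _≟_; _<_; _≤_; _<?_)
import Data.Fin.Properties as Finₚ
open import Data.Fin.Subset using (Subset; ⁅_⁆; inside; outside)
open import Data.Fin.Subset.Properties using (∪-comm)
open import Data.Vec using (Vec; []; _∷_; lookup; _[_]≔_)
open import Data.Vec.Properties
  using (lookup∘update; lookup∘update′; lookup-zipWith; lookup-replicate; tabulate∘lookup; tabulate-cong)
open import Data.List using (List; []; _∷_; map; _++_; allFin; length; filterᵇ)
import Data.List.Properties as Listₚ
open import Data.List.Relation.Unary.All as All using (All; []; _∷_)
open import Data.List.Relation.Unary.All.Properties using (++⁺)
open import Data.List.Membership.Propositional.Properties using (∈-map⁺; ∈-allFin)
open import Data.Product using (Σ; ∃; ∃₂; _×_; _,_; proj₁; proj₂)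
open import Data.Sum using (_⊎_; inj₁; inj₂; [_,_]′)
open import Data.Empty using (⊥-elim)
open import Data.Unit using (tt)
open import Function using (id; _∘_; Equivalence)
open import Induction.WellFounded using (Acc; acc)
open import Relation.Nullary using (¬_; yes; no; does; ¬?)
open import Relation.Nullary.Decidable using (dec-true; dec-false; decidable-stable; _×-dec_)
open import Relation.Binary.Core using (Rel)
open import Relation.Binary.Definitions using (_Respects_; DecidableEquality)
open import Relation.Binary.PropositionalEquality
open import Relation.Binary.Construct.Closure.ReflexiveTransitive using (Star; ε; _◅_; _◅◅_)

private
  variable
    n : ℕ

star-respects : ∀ {A : Set} {ℓ} {R : Rel A ℓ} {P : A → Set} → P Respects R → P Respects Star R
star-respects step ε        = id
star-respects step (r ◅ rs) = star-respects step rs ∘ step r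

vec-ext : ∀ {A : Set} {xs ys : Vec A n} → (∀ p → lookup xs p ≡ lookup ys p) → xs ≡ ys
vec-ext {xs = xs} {ys} eq = trans (sym (tabulate∘lookup xs)) (trans (tabulate-cong eq) (tabulate∘lookup ys))

lookup-⁅⁆ : (a p : Fin n) → lookup ⁅ a ⁆ p ≡ does (p ≟ a)
lookup-⁅⁆ zero    zero    = refl
lookup-⁅⁆ zero    (suc p) = lookup-replicate p false
lookup-⁅⁆ (suc a) zero    = refl
lookup-⁅⁆ (suc a) (suc p) = lookup-⁅⁆ a p

lookup-⟨⟩ : (a b p : Fin n) → lookup ⟨ a , b ⟩ p ≡ does (p ≟ a) ∨ does (p ≟ b)
lookup-⟨⟩ a b p = trans (lookup-zipWith _∨_ p ⁅ a ⁆ ⁅ b ⁆) (cong₂ _∨_ (lookup-⁅⁆ a p) (lookup-⁅⁆ b p))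

lookup-⟨⟩ˡ : (a b : Fin n) → lookup ⟨ a , b ⟩ a ≡ true
lookup-⟨⟩ˡ a b rewrite lookup-⟨⟩ a b a | dec-true (a ≟ a) refl = refl

lookup-⟨⟩ʳ : (a b : Fin n) → lookup ⟨ a , b ⟩ b ≡ true
lookup-⟨⟩ʳ a b rewrite lookup-⟨⟩ a b b | dec-true (b ≟ b) refl = ∨-zeroʳ _

lookup-⟨⟩-≢ : {a b p : Fin n} → p ≢ a → p ≢ b → lookup ⟨ a , b ⟩ p ≡ false
lookup-⟨⟩-≢ {a = a} {b} {p} p≢a p≢b
  rewrite lookup-⟨⟩ a b p | dec-false (p ≟ a) p≢a | dec-false (p ≟ b) p≢b = refl

lookup-⟨⟩⁻ : (a b p : Fin n) → lookup ⟨ a , b ⟩ p ≡ true → p ≡ a ⊎ p ≡ b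
lookup-⟨⟩⁻ a b p p∈ab rewrite lookup-⟨⟩ a b p with p ≟ a | p ≟ b
... | yes p≡a | _       = inj₁ p≡a
... | no _    | yes p≡b = inj₂ p≡b
... | no _    | no _    with () ← p∈ab

⟨⟩-comm : (a b : Fin n) → ⟨ a , b ⟩ ≡ ⟨ b , a ⟩
⟨⟩-comm a b = ∪-comm ⁅ a ⁆ ⁅ b ⁆

move : Fin n → Fin n → Subset n → Subset n
move i j S = (S [ j ]≔ outside) [ i ]≔ inside

lookup-move-target : (i j : Fin n) (S : Subset n) → lookup (move i j S) i ≡ true
lookup-move-target i j S = lookup∘update i (S [ j ]≔ outside) inside

lookup-move-source : {i j : Fin n} (S : Subset n) → j ≢ i → lookup (move i j S) j ≡ false
lookup-move-source {j = j} S j≢i =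
  trans (lookup∘update′ j≢i (S [ j ]≔ outside) inside) (lookup∘update j S outside)

lookup-move-other : {i j p : Fin n} (S : Subset n) → p ≢ i → p ≢ j → lookup (move i j S) p ≡ lookup S p
lookup-move-other {j = j} S p≢i p≢j =
  trans (lookup∘update′ p≢i (S [ j ]≔ outside) inside) (lookup∘update′ p≢j S outside)

move-⟨⟩ˡ : {a b c : Fin n} → a ≢ b → c ≢ b → c ≢ a → move c a ⟨ a , b ⟩ ≡ ⟨ c , b ⟩
move-⟨⟩ˡ {a = a} {b} {c} a≢b c≢b c≢a = vec-ext pointwise
  where
  pointwise : ∀ p → lookup (move c a ⟨ a , b ⟩) p ≡ lookup ⟨ c , b ⟩ p
  pointwise p with p ≟ c | p ≟ a | p ≟ b
  ... | yes refl | _        | _        = trans (lookup-move-target p a ⟨ a , b ⟩) (sym (lookup-⟨⟩ˡ p b))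
  ... | no p≢c   | yes refl | _        =
    trans (lookup-move-source ⟨ a , b ⟩ (c≢a ∘ sym)) (sym (lookup-⟨⟩-≢ p≢c a≢b))
  ... | no p≢c   | no p≢a   | yes refl =
    trans (lookup-move-other ⟨ a , b ⟩ p≢c p≢a) (trans (lookup-⟨⟩ʳ a p) (sym (lookup-⟨⟩ʳ c p)))
  ... | no p≢c   | no p≢a   | no p≢b   =
    trans (lookup-move-other ⟨ a , b ⟩ p≢c p≢a) (trans (lookup-⟨⟩-≢ p≢a p≢b) (sym (lookup-⟨⟩-≢ p≢c p≢b)))

move-⟨⟩ʳ : {a b c : Fin n} → a ≢ b → c ≢ b → c ≢ a → move c b ⟨ a , b ⟩ ≡ ⟨ a , c ⟩
move-⟨⟩ʳ {a = a} {b} {c} a≢b c≢b c≢a = begin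
  move c b ⟨ a , b ⟩ ≡⟨ cong (move c b) (⟨⟩-comm a b) ⟩
  move c b ⟨ b , a ⟩ ≡⟨ move-⟨⟩ˡ (a≢b ∘ sym) c≢a c≢b ⟩
  ⟨ c , a ⟩          ≡⟨ ⟨⟩-comm c a ⟩
  ⟨ a , c ⟩          ∎
  where open ≡-Reasoning

C-fixes-or-moves : (E : List (Subset n)) (i j : Fin n) (S : Subset n) →
  C E i j S ≡ S ⊎
  (C E i j S ≡ move i j S × lookup S j ≡ true × lookup S i ≡ false × ¬ move i j S ∈ E)
C-fixes-or-moves E i j S with lookup S j | lookup S i | move i j S ∈? E
... | false | _     | _      = inj₁ refl
... | true  | true  | _      = inj₁ refl
... | true  | false | yes _  = inj₁ refl
... | true  | false | no ∉E  = inj₂ (refl , refl , refl , ∉E)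

∈-ShiftE : {E : List (Subset n)} (i j : Fin n) {S : Subset n} → S ∈ E → C E i j S ∈ ShiftE i j E
∈-ShiftE {E = E} i j = ∈-map⁺ (C E i j)

∈-ShiftE-∋ : {E : List (Subset n)} (i j : Fin n) {S : Subset n} →
  S ∈ E → lookup S i ≡ true → S ∈ ShiftE i j E
∈-ShiftE-∋ {E = E} i j {S} S∈E i∈S with C-fixes-or-moves E i j S
... | inj₁ fixed                    = subst (_∈ ShiftE i j E) fixed (∈-ShiftE i j S∈E)
... | inj₂ (_ , _ , i∉S , _) with () ← trans (sym i∈S) i∉S

move-∈-or-∈-ShiftE : {E : List (Subset n)} (i j : Fin n) {S : Subset n} →
  S ∈ E → lookup S j ≡ true → lookup S i ≡ false → move i j S ∈ E ⊎ move i j S ∈ ShiftE i j E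
move-∈-or-∈-ShiftE {E = E} i j {S} S∈E j∈S i∉S with move i j S ∈? E
... | yes moved∈E = inj₁ moved∈E
... | no moved∉E  = inj₂ (subst (_∈ ShiftE i j E) C≡move (∈-ShiftE i j S∈E))
  where
  C≡move : C E i j S ≡ move i j S
  C≡move rewrite j∈S | i∉S | dec-false (move i j S ∈? E) moved∉E = refl

Shifts-++ : (p q : List (Fin n × Fin n)) (E : List (Subset n)) → Shifts (p ++ q) E ≡ Shifts q (Shifts p E)
Shifts-++ []            q E = refl
Shifts-++ ((i , j) ∷ p) q E = Shifts-++ p q (ShiftE i j E)

FullStar : {m : ℕ} → List (Subset (suc m)) → Set
FullStar {m} E = (k : Fin m) → IsEdge E zero (suc k)

module _ {m : ℕ} where

  private
    Edges = List (Subset (suc m))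
    Vertex = Fin (suc m)

  Reached : Edges → Vertex → Set
  Reached E u = u ≡ zero ⊎ IsEdge E zero u

  data _⇒₀_ (E : Edges) : Edges → Set where
    shift₀ : {x : Vertex} → IsEdge E zero x → E ⇒₀ ShiftE zero x E

  reached-⇒₀ : {y : Vertex} → (λ E → Reached E y) Respects _⇒₀_
  reached-⇒₀ _                  (inj₁ y≡0)          = inj₁ y≡0
  reached-⇒₀ {y} (shift₀ {x} _) (inj₂ (0≢y , 0y∈E)) =
    inj₂ (0≢y , ∈-ShiftE-∋ zero x 0y∈E (lookup-⟨⟩ˡ zero y))

  shift₀-reaches : {E : Edges} {x w : Vertex} →
    IsEdge E zero x → ⟨ x , w ⟩ ∈ E → x ≢ w → Reached (ShiftE zero x E) w
  shift₀-reaches {E} {x} {w} (0≢x , _) xw∈E x≢w with w ≟ zero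
  ... | yes w≡0 = inj₁ w≡0
  ... | no w≢0  = inj₂ (w≢0 ∘ sym , [ keep ∘ moved , moved ]′
    (move-∈-or-∈-ShiftE zero x xw∈E (lookup-⟨⟩ˡ x w) (lookup-⟨⟩-≢ 0≢x (w≢0 ∘ sym))))
    where
    moved : ∀ {L : Edges} → move zero x ⟨ x , w ⟩ ∈ L → ⟨ zero , w ⟩ ∈ L
    moved {L} = subst (_∈ L) (move-⟨⟩ˡ x≢w (w≢0 ∘ sym) 0≢x)
    keep : ⟨ zero , w ⟩ ∈ E → ⟨ zero , w ⟩ ∈ ShiftE zero x E
    keep 0w∈E = ∈-ShiftE-∋ zero x 0w∈E (lookup-⟨⟩ˡ zero w)

  module _ (E₀ : Edges) where

    Tracks : Edges → Set
    Tracks E = (u v : Vertex) → IsEdge E₀ u v → ⟨ u , v ⟩ ∈ E ⊎ (Reached E u × Reached E v)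

    tracks-⇒₀ : Tracks Respects _⇒₀_
    tracks-⇒₀ {E} step@(shift₀ {x} 0x) tracks u v uv with tracks u v uv
    ... | inj₂ (u-reached , v-reached) = inj₂ (reached-⇒₀ step u-reached , reached-⇒₀ step v-reached)
    ... | inj₁ uv∈E with C-fixes-or-moves E zero x ⟨ u , v ⟩
    ...   | inj₁ fixed = inj₁ (subst (_∈ ShiftE zero x E) fixed (∈-ShiftE zero x uv∈E))
    ...   | inj₂ (_ , x∈uv , _) with lookup-⟨⟩⁻ u v x x∈uv
    ...     | inj₁ refl = inj₂ (reached-⇒₀ step (inj₂ 0x) , shift₀-reaches 0x uv∈E (proj₁ uv))
    ...     | inj₂ refl =
      inj₂ (shift₀-reaches 0x (subst (_∈ E) (⟨⟩-comm u x) uv∈E) (proj₁ uv ∘ sym) , reached-⇒₀ step (inj₂ 0x))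

    reach : {E : Edges} {u v : Vertex} → Star (IsEdge E₀) u v → Tracks E → Reached E u →
      ∃ λ E′ → Star _⇒₀_ E E′ × Reached E′ v
    reach ε tracks u-reached = _ , ε , u-reached
    reach {u = u} (_◅_ {j = w} uw path) tracks u-reached with tracks u w uw
    ... | inj₂ (_ , w-reached) = reach path tracks w-reached
    ... | inj₁ uw∈E with u-reached
    ...   | inj₁ refl = reach path tracks (inj₂ (proj₁ uw , uw∈E))
    ...   | inj₂ 0u =
      let E′ , steps , v-reached =
            reach path (tracks-⇒₀ (shift₀ 0u) tracks) (shift₀-reaches 0u uw∈E (proj₁ uw))
      in E′ , shift₀ 0u ◅ steps , v-reached

    reach-all : ((v : Vertex) → Star (IsEdge E₀) zero v) → {E : Edges} → Tracks E → (vs : List Vertex) →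
      ∃ λ E′ → Star _⇒₀_ E E′ × All (Reached E′) vs
    reach-all paths tracks []       = _ , ε , []
    reach-all paths tracks (v ∷ vs) =
      let E₁ , steps₁ , v-reached  = reach (paths v) tracks (inj₁ refl)
          E₂ , steps₂ , vs-reached = reach-all paths (star-respects tracks-⇒₀ steps₁ tracks) vs
      in E₂ , steps₁ ◅◅ steps₂ , star-respects reached-⇒₀ steps₂ v-reached ∷ vs-reached

  pairs : {E E′ : Edges} → Star _⇒₀_ E E′ → List (Vertex × Vertex)
  pairs ε                  = []
  pairs (shift₀ {x} _ ◅ s) = (zero , x) ∷ pairs s

  Shifts-pairs : {E E′ : Edges} (s : Star _⇒₀_ E E′) → Shifts (pairs s) E ≡ E′
  Shifts-pairs ε              = refl
  Shifts-pairs (shift₀ _ ◅ s) = Shifts-pairs s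

  pairs-ordered : {E E′ : Edges} (s : Star _⇒₀_ E E′) → AllOrdered (pairs s)
  pairs-ordered ε                      = []
  pairs-ordered (shift₀ (0≢x , _) ◅ s) = Finₚ.≤∧≢⇒< z≤n 0≢x ∷ pairs-ordered s

  pairs-edgeShifts : {E E′ : Edges} (s : Star _⇒₀_ E E′) → EdgeShiftSeq E (pairs s)
  pairs-edgeShifts ε               = tt
  pairs-edgeShifts (shift₀ 0x ◅ s) = 0x , pairs-edgeShifts s

  fullStar-by-edgeShifts : (G : Graph (suc m)) → Connected G →
    Σ (List (Vertex × Vertex)) λ p → AllOrdered p × EdgeShiftSeq (E G) p × FullStar (Shifts p (E G))
  fullStar-by-edgeShifts G connected =
    let _ , steps , all-reached = reach-all (E G) (connected zero) initially (allFin (suc m))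
    in pairs steps , pairs-ordered steps , pairs-edgeShifts steps ,
       λ k → joined (subst (λ E′ → Reached E′ (suc k)) (sym (Shifts-pairs steps))
                           (All.lookup all-reached (∈-allFin (suc k))))
    where
    initially : Tracks (E G) (E G)
    initially u v uv = inj₁ (proj₂ uv)
    joined : ∀ {E′ k} → Reached E′ (suc k) → IsEdge E′ zero (suc k)
    joined (inj₂ 0k) = 0k

weightFrom : ℕ → Vec Bool n → ℕ
weightFrom c []      = 0
weightFrom c (b ∷ v) = (if b then c else 0) + weightFrom (suc c) v

weight : Subset n → ℕ
weight = weightFrom 0

private
  +-interchange : ∀ h c q r → h + (suc c + q + r) ≡ (c + suc q) + (h + r)
  +-interchange = solve 4 (λ h c q r → h :+ (con 1 :+ c :+ q :+ r) := (c :+ (con 1 :+ q)) :+ (h :+ r)) refl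
    where open +-*-Solver

weightFrom-clear : ∀ c (v : Vec Bool n) p → lookup v p ≡ true →
  weightFrom c v ≡ (c + toℕ p) + weightFrom c (v [ p ]≔ false)
weightFrom-clear c (true ∷ v) zero    refl = cong (_+ weightFrom (suc c) v) (sym (ℕₚ.+-identityʳ c))
weightFrom-clear c (b ∷ v)    (suc p) p∈v  =
  trans (cong ((if b then c else 0) +_) (weightFrom-clear (suc c) v p p∈v)) (+-interchange _ c (toℕ p) _)

weightFrom-set : ∀ c (v : Vec Bool n) p → lookup v p ≡ false →
  weightFrom c (v [ p ]≔ true) ≡ (c + toℕ p) + weightFrom c v
weightFrom-set c (false ∷ v) zero    refl = cong (_+ weightFrom (suc c) v) (sym (ℕₚ.+-identityʳ c))
weightFrom-set c (b ∷ v)     (suc p) p∉v  =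
  trans (cong ((if b then c else 0) +_) (weightFrom-set (suc c) v p p∉v)) (+-interchange _ c (toℕ p) _)

weight-move : {i j : Fin n} (S : Subset n) → i < j → lookup S j ≡ true → lookup S i ≡ false →
  weight (move i j S) ℕ.< weight S
weight-move {n} {i} {j} S i<j j∈S i∉S = begin-strict
  weight (move i j S) ≡⟨ weightFrom-set 0 S∖j i i∉S∖j ⟩
  toℕ i + weight S∖j  <⟨ ℕₚ.+-monoˡ-< (weight S∖j) i<j ⟩
  toℕ j + weight S∖j  ≡⟨ weightFrom-clear 0 S j j∈S ⟨
  weight S            ∎
  where
  open ℕₚ.≤-Reasoning
  S∖j : Subset n
  S∖j = S [ j ]≔ false
  i∉S∖j : lookup S∖j i ≡ false
  i∉S∖j = trans (lookup∘update′ (Finₚ.<⇒≢ i<j) S false) i∉S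

module _ {A : Set} (g : A → ℕ) (f : A → A) (f-lowers : ∀ x → f x ≡ x ⊎ g (f x) ℕ.< g x) where

  sum-map-≤ : ∀ xs → sum (map g (map f xs)) ℕ.≤ sum (map g xs)
  sum-map-≤ []       = z≤n
  sum-map-≤ (x ∷ xs) with f-lowers x
  ... | inj₁ fx≡x rewrite fx≡x = ℕₚ.+-monoʳ-≤ (g x) (sum-map-≤ xs)
  ... | inj₂ fx<x = ℕₚ.+-mono-≤ (ℕₚ.<⇒≤ fx<x) (sum-map-≤ xs)

  sum-map-< : ∀ xs → map f xs ≢ xs → sum (map g (map f xs)) ℕ.< sum (map g xs)
  sum-map-< []       changed = ⊥-elim (changed refl)
  sum-map-< (x ∷ xs) changed with f-lowers x
  ... | inj₁ fx≡x rewrite fx≡x = ℕₚ.+-monoʳ-< (g x) (sum-map-< xs (changed ∘ cong (x ∷_)))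
  ... | inj₂ fx<x = ℕₚ.+-mono-<-≤ fx<x (sum-map-≤ xs)

potential : List (Subset n) → ℕ
potential E = sum (map weight E)

ShiftE-lowers-potential : {E : List (Subset n)} {i j : Fin n} → i < j → ShiftE i j E ≢ E →
  potential (ShiftE i j E) ℕ.< potential E
ShiftE-lowers-potential {E = E} {i} {j} i<j = sum-map-< weight (C E i j) C-lowers E
  where
  C-lowers : ∀ S → C E i j S ≡ S ⊎ weight (C E i j S) ℕ.< weight S
  C-lowers S with C-fixes-or-moves E i j S
  ... | inj₁ fixed                    = inj₁ fixed
  ... | inj₂ (moved , j∈S , i∉S , _) rewrite moved = inj₂ (weight-move S i<j j∈S i∉S)

_≟ᴱ_ : DecidableEquality (List (Subset n))
_≟ᴱ_ = Listₚ.≡-dec _≟ˢ_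

Stable : List (Subset n) → Set
Stable {n} E = {i j : Fin n} → i < j → ShiftE i j E ≡ E

stable-or-changed : (E : List (Subset n)) → Stable E ⊎ ∃₂ λ i j → i < j × ShiftE i j E ≢ E
stable-or-changed E with Finₚ.any? (λ i → Finₚ.any? λ j → (i <? j) ×-dec ¬? (ShiftE i j E ≟ᴱ E))
... | yes (i , j , i<j , changed) = inj₂ (i , j , i<j , changed)
... | no ¬changed                 =
  inj₁ λ {i} {j} i<j → decidable-stable (ShiftE i j E ≟ᴱ E) λ changed → ¬changed (i , j , i<j , changed)

stabilise : (E : List (Subset n)) → Σ (List (Fin n × Fin n)) λ p → AllOrdered p × Stable (Shifts p E)
stabilise E = go E (<-wellFounded (potential E))
  where
  go : ∀ E → Acc ℕ._<_ (potential E) → Σ (List _) λ p → AllOrdered p × Stable (Shifts p E)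
  go E (acc smaller) with stable-or-changed E
  ... | inj₁ stable                  = [] , [] , stable
  ... | inj₂ (i , j , i<j , changed) =
    let p , ordered , stable = go (ShiftE i j E) (smaller (ShiftE-lowers-potential i<j changed))
    in (i , j) ∷ p , i<j ∷ ordered , stable

module _ {E : List (Subset n)} (stable : Stable E) where

  stable-lowerˡ : {a b c : Fin n} → ⟨ a , b ⟩ ∈ E → a ≢ b → c ≤ a → c ≢ b → ⟨ c , b ⟩ ∈ E
  stable-lowerˡ {a} {b} {c} ab∈E a≢b c≤a c≢b with c ≟ a
  ... | yes refl = ab∈E
  ... | no c≢a   = subst (_∈ E) (move-⟨⟩ˡ a≢b c≢b c≢a) moved∈E
    where
    c<a : c < a
    c<a = Finₚ.≤∧≢⇒< c≤a c≢a
    moved∈E : move c a ⟨ a , b ⟩ ∈ E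
    moved∈E = [ id , subst (_ ∈_) (stable c<a) ]′
      (move-∈-or-∈-ShiftE c a ab∈E (lookup-⟨⟩ˡ a b) (lookup-⟨⟩-≢ c≢a c≢b))

  stable-lowerʳ : {a b c : Fin n} → ⟨ a , b ⟩ ∈ E → a ≢ b → c ≤ b → c ≢ a → ⟨ a , c ⟩ ∈ E
  stable-lowerʳ {a} {b} {c} ab∈E a≢b c≤b c≢a =
    subst (_∈ E) (⟨⟩-comm c a) (stable-lowerˡ (subst (_∈ E) (⟨⟩-comm a b) ab∈E) (a≢b ∘ sym) c≤b c≢a)

  stable⇒shifted : Shifted E
  stable⇒shifted a b a′ b′ (a≢b , ab∈E) a′≤a b′≤b a′≢b′ with a′ ≟ b
  ... | no a′≢b  = a′≢b′ , stable-lowerʳ (stable-lowerˡ ab∈E a≢b a′≤a a′≢b) a′≢b b′≤b (a′≢b′ ∘ sym)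
  ... | yes refl = a′≢b′ , stable-lowerˡ (stable-lowerʳ ab∈E a≢b b′≤b b′≢a) (b′≢a ∘ sym) a′≤a a′≢b′
    where
    b′≢a : b′ ≢ a
    b′≢a = Finₚ.<⇒≢ (ℕₚ.<-≤-trans (Finₚ.≤∧≢⇒< b′≤b (a′≢b′ ∘ sym)) a′≤a)

fullStar-ShiftE : {m : ℕ} {E : List (Subset (suc m))} {i j : Fin (suc m)} →
  i < j → FullStar E → FullStar (ShiftE i j E)
fullStar-ShiftE {E = E} {i} {j} i<j star k with C-fixes-or-moves E i j ⟨ zero , suc k ⟩
... | inj₁ fixed = proj₁ (star k) , subst (_∈ ShiftE i j E) fixed (∈-ShiftE i j (proj₂ (star k)))
... | inj₂ (_ , j∈0k , i∉0k , moved∉E) with lookup-⟨⟩⁻ zero (suc k) j j∈0k | i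
...   | inj₁ refl | _     with () ← i<j
...   | inj₂ refl | zero  with () ← i∉0k
...   | inj₂ refl | suc l =
  ⊥-elim (moved∉E (subst (_∈ E) (sym (move-⟨⟩ʳ {a = zero} (λ ()) (Finₚ.<⇒≢ i<j) λ ())) (proj₂ (star l))))

fullStar-Shifts : {m : ℕ} {E : List (Subset (suc m))} {p : List (Fin (suc m) × Fin (suc m))} →
  AllOrdered p → FullStar E → FullStar (Shifts p E)
fullStar-Shifts []               star = star
fullStar-Shifts (i<j ∷ ordered) star = fullStar-Shifts ordered (fullStar-ShiftE i<j star)

m₁-fullStar : {m : ℕ} {E : List (Subset (suc m))} → FullStar E → m₁ E ≡ m
m₁-fullStar {m} {E} star = begin
  length (filterᵇ (λ k → does (⟨ zero , suc k ⟩ ∈? E)) (allFin m))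
    ≡⟨ cong length (Listₚ.filter-all _ (All.universal counted (allFin m))) ⟩
  length (allFin m)
    ≡⟨ Listₚ.length-tabulate id ⟩
  m ∎
  where
  open ≡-Reasoning
  counted : ∀ k → T (does (⟨ zero , suc k ⟩ ∈? E))
  counted k = Equivalence.from T-≡ (dec-true (⟨ zero , suc k ⟩ ∈? E) (proj₂ (star k)))

lemma4p5 : (m : ℕ) (G : Graph (suc m)) → Connected G →
    (Σ (List (Fin (suc m) × Fin (suc m))) λ p →
       AllOrdered p × EdgeShiftSeq (E G) p
       × ((k : Fin m) → IsEdge (Shifts p (E G)) zero (suc k)))
    × (Σ (List (Fin (suc m) × Fin (suc m))) λ p →
       AllOrdered p × Shifted (Shifts p (E G)) × m₁ (Shifts p (E G)) ≡ m)
lemma4p5 m G connected =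
  let p , p-ordered , p-edgeShifts , star = fullStar-by-edgeShifts G connected
      q , q-ordered , stable              = stabilise (Shifts p (E G))
      p++q-shifts = sym (Shifts-++ p q (E G))
  in (p , p-ordered , p-edgeShifts , star)
   , (p ++ q , ++⁺ p-ordered q-ordered
     , subst Shifted p++q-shifts (stable⇒shifted stable)
     , subst (λ E′ → m₁ E′ ≡ m) p++q-shifts (m₁-fullStar (fullStar-Shifts q-ordered star)))
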